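{- Let $G$ be a connected $3K_1$-free graph. Then for every two distinct vertices $u,v\in V(G)$, $G$ has a path cover $\mathrm{PC}(u,v)$.
   Context: Graphs are finite, simple and undirected. $3K_1$-free means no independent set of size 3. $\mathrm{PC}(u,v)$ denotes a path cover of size 2 with one path starting at $u$ and the other starting at $v$, i.e., two vertex-disjoint paths (possibly consisting of a single vertex), one with an end-vertex $u$ and the other with an end-vertex $v$, whose vertex sets together cover $V(G)$. -}

module Defs where

open import Data.Nat using (ℕ)
open import Data.Fin using (Fin)
open import Data.List using (List; []; _∷_; _++_)
open import Data.List.Membership.Propositional using (_∈_)
open import Data.List.Relation.Unary.Unique.Propositional using (Unique)
open import Data.Product using (Σ; _×_; _,_; ∃)
open import Data.Sum using (_⊎_)
open import Relation.Nullary using (¬_; Dec)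
open import Relation.Binary.PropositionalEquality using (_≡_)
open import Level using (0ℓ)

record Graph (n : ℕ) : Set₁ where
  field
    Adj     : Fin n → Fin n → Set
    adj?    : ∀ x y → Dec (Adj x y)
    sym     : ∀ {x y} → Adj x y → Adj y x
    irrefl  : ∀ {x} → ¬ Adj x x

module _ {n : ℕ} (G : Graph n) where
  open Graph G

  data Chain : List (Fin n) → Set where
    []  : Chain []
    [_] : ∀ x → Chain (x ∷ [])
    _∷_ : ∀ {x y xs} → Adj x y → Chain (y ∷ xs) → Chain (x ∷ y ∷ xs)

  record PathFrom (x : Fin n) : Set where
    constructor path
    field
      rest   : List (Fin n)
      chain  : Chain (x ∷ rest)
      unique : Unique (x ∷ rest)

  open PathFrom public

  verts : ∀ {x} → PathFrom x → List (Fin n)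
  verts {x} p = x ∷ rest p

  HasPath : Fin n → Fin n → Set
  HasPath x y = Σ (PathFrom x) λ p → y ∈ verts p

  Connected : Set
  Connected = ∀ x y → HasPath x y

  ThreeK1Free : Set
  ThreeK1Free = ∀ x y z → ¬ x ≡ y → ¬ y ≡ z → ¬ x ≡ z →
                Adj x y ⊎ Adj y z ⊎ Adj x z

  -- PC(u,v): two vertex-disjoint paths, one with end-vertex u, the other
  -- with end-vertex v, whose vertex sets together cover V(G)
  PC : Fin n → Fin n → Set
  PC u v = Σ (PathFrom u) λ p → Σ (PathFrom v) λ q →
             Unique (verts p ++ verts q) × (∀ w → w ∈ verts p ++ verts q)

-- Grow a pair of disjoint paths P from u and Q from v, starting from the trivial paths u and v.
-- As long as some vertex is uncovered, connectivity yields an uncovered w adjacent to a covered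
-- c, say on P (the case c ∈ Q is symmetric); let c′ be the successor of c on P and b the end of Q.
-- If c is the end of P, append w to P; if w ~ c′, insert w between c and c′; if w ~ b, append w
-- to Q.  Otherwise w, c′, b are pairwise non-adjacent except possibly c′ ~ b, so 3K₁-freeness
-- forces c′ ~ b: cut P after c and append w to it, and move the rest c′ … of P onto the end of Q.
-- Each step covers one more vertex, so the process stops with a path cover PC(u,v).
module Submission where

open import Defs
open import Data.Nat using (ℕ; zero; suc)
open import Data.Fin using (Fin)
open import Data.Fin.Properties using (_≟_; ≡-decSetoid; all?; ¬∀⟶∃¬)
open import Data.List using (List; []; _∷_; _++_; head; initLast; _∷ʳ′_)
open import Data.List.Properties using (++-identityʳ)
open import Data.List.Membership.Propositional using (_∈_; _∉_)
open import Data.List.Membership.Propositional.Properties using (∈-∃++; ∈-++⁻; ∈-++⁺ˡ; ∈-++⁺ʳ)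
open import Data.List.Relation.Unary.Any using (here; there)
open import Data.List.Relation.Unary.All as All using ()
open import Data.List.Relation.Unary.All.Properties using (¬Any⇒All¬; ++⁻ˡ)
open import Data.List.Relation.Unary.AllPairs using (_∷_)
open import Data.List.Relation.Unary.Unique.Propositional using (Unique; [])
open import Data.List.Relation.Binary.Subset.Propositional using (_⊆_)
open import Data.List.Relation.Binary.Disjoint.Propositional using (Disjoint)
open import Data.List.Relation.Binary.Permutation.Propositional
  using (_↭_; ↭-refl; ↭-prep; ↭-sym; ↭-trans; ↭-reflexive; ↭⇒↭ₛ; module PermutationReasoning)
open import Data.List.Relation.Binary.Permutation.Propositional.Properties
  using (∈-resp-↭; ++-comm; ++⁺ˡ; ∷↭∷ʳ; ++-commutativeMonoid)
import Data.List.Relation.Binary.Permutation.Setoid.Properties as Permutationₛ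
open import Data.Maybe using (just)
open import Data.Product using (Σ; ∃₂; _×_; _,_; proj₁; proj₂)
open import Data.Sum as Sum using (_⊎_; inj₁; inj₂)
open import Function using (_∘_)
open import Function.Construct.Identity using (injection)
open import Relation.Nullary using (¬_; yes; no; contradiction)
open import Relation.Binary.PropositionalEquality using (_≡_; _≢_; refl; trans; setoid)

module _ {A : Set} where

  head-++-∷ : ∀ (xs : List A) {x ys zs} → head (xs ++ x ∷ ys) ≡ head (xs ++ x ∷ zs)
  head-++-∷ []      = refl
  head-++-∷ (_ ∷ _) = refl

  head≡just⇒∈ : ∀ {xs : List A} {x} → head xs ≡ just x → x ∈ xs
  head≡just⇒∈ {_ ∷ _} refl = here refl

  Unique-∷ : ∀ {x} {xs : List A} → x ∉ xs → Unique xs → Unique (x ∷ xs)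
  Unique-∷ x∉xs u = ¬Any⇒All¬ _ x∉xs ∷ u

  Unique-++⁻ : ∀ (xs : List A) {ys} → Unique (xs ++ ys) → Unique xs × Unique ys × Disjoint xs ys
  Unique-++⁻ []       u          = [] , u , λ ()
  Unique-++⁻ (x ∷ xs) (x∉ ∷ u) with Unique-++⁻ xs u
  ... | uxs , uys , disjoint = ++⁻ˡ xs x∉ ∷ uxs , uys , λ where
    (here refl  , y∈ys) → All.lookup x∉ (∈-++⁺ʳ xs y∈ys) refl
    (there x∈xs , y∈ys) → disjoint (x∈xs , y∈ys)

  Unique-resp-↭ : ∀ {xs ys : List A} → xs ↭ ys → Unique xs → Unique ys
  Unique-resp-↭ xs↭ys = Permutationₛ.Unique-resp-↭ (setoid A) (↭⇒↭ₛ xs↭ys)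

  -- Lists form a commutative monoid up to _↭_; the solver treats the singletons c ∷ [] as atoms.
  open import Algebra.Solver.CommutativeMonoid (++-commutativeMonoid {A = A})

  ↭-splice : ∀ (ps qs xs ys zs : List A) {c b w} → xs ++ ys ↭ w ∷ zs →
             (ps ++ c ∷ xs) ++ (qs ++ b ∷ ys) ↭ w ∷ (ps ++ c ∷ zs) ++ (qs ++ b ∷ [])
  ↭-splice ps qs xs ys zs {c} {b} {w} perm = begin
    (ps ++ c ∷ xs) ++ (qs ++ b ∷ ys)
      ↭⟨ solve 6 (λ P Q X Y c b → (P ⊕ (c ⊕ X)) ⊕ (Q ⊕ (b ⊕ Y))
                                  ⊜ (P ⊕ (c ⊕ (Q ⊕ b))) ⊕ (X ⊕ Y))
                 ↭-refl ps qs xs ys (c ∷ []) (b ∷ []) ⟩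
    (ps ++ c ∷ qs ++ b ∷ []) ++ xs ++ ys
      ↭⟨ ++⁺ˡ (ps ++ c ∷ qs ++ b ∷ []) perm ⟩
    (ps ++ c ∷ qs ++ b ∷ []) ++ w ∷ zs
      ↭⟨ solve 6 (λ P Q Z c b w → (P ⊕ (c ⊕ (Q ⊕ b))) ⊕ (w ⊕ Z)
                                    ⊜ w ⊕ ((P ⊕ (c ⊕ Z)) ⊕ (Q ⊕ b)))
                 ↭-refl ps qs zs (c ∷ []) (b ∷ []) (w ∷ []) ⟩
    w ∷ (ps ++ c ∷ zs) ++ (qs ++ b ∷ [])
      ∎
    where open PermutationReasoning

module _ {n : ℕ} where
  open import Data.List.Countdown (≡-decSetoid n) using (_⊕_; empty)

  ⊕-mono : ∀ {xs ys k} → xs ⊆ ys → xs ⊕ k → ys ⊕ k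
  ⊕-mono xs⊆ys count = record
    { kind      = Sum.map₁ xs⊆ys ∘ kind
    ; injective = λ eq₁ eq₂ → injective (map₁≡inj₂ eq₁) (map₁≡inj₂ eq₂)
    }
    where
    open _⊕_ count
    map₁≡inj₂ : ∀ {B C D : Set} {f : B → C} {s : B ⊎ D} {d} →
                Sum.map₁ f s ≡ inj₂ d → s ≡ inj₂ d
    map₁≡inj₂ {s = inj₂ _} refl = refl

  ⊕-Fin : ∀ (xs : List (Fin n)) → xs ⊕ n
  ⊕-Fin xs = ⊕-mono (λ ()) (empty (injection _))

module _ {n : ℕ} (G : Graph n) where
  open Graph G renaming (sym to Adj-sym)
  open import Data.List.Membership.DecPropositional (_≟_ {n}) using (_∈?_)
  open import Data.List.Countdown (≡-decSetoid n) using (_⊕_; lookup!; insert)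

  chain-split : ∀ ps {c qs} → Chain G (ps ++ c ∷ qs) → Chain G (ps ++ c ∷ []) × Chain G (c ∷ qs)
  chain-split []           ch       = [ _ ] , ch
  chain-split (_ ∷ [])     (a ∷ ch) = a ∷ [ _ ] , ch
  chain-split (_ ∷ p ∷ ps) (a ∷ ch) with chain-split (p ∷ ps) ch
  ... | front , back = a ∷ front , back

  chain-join : ∀ ps {c qs} → Chain G (ps ++ c ∷ []) → Chain G (c ∷ qs) → Chain G (ps ++ c ∷ qs)
  chain-join []           _           back = back
  chain-join (_ ∷ [])     (a ∷ _)     back = a ∷ back
  chain-join (_ ∷ p ∷ ps) (a ∷ front) back = a ∷ chain-join (p ∷ ps) front back

  EdgeLeaving : List (Fin n) → Set
  EdgeLeaving M = ∃₂ λ c w → c ∈ M × w ∉ M × Adj c w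

  chain-edgeLeaving : ∀ {M x xs y} → Chain G (x ∷ xs) → x ∈ M → y ∈ x ∷ xs → y ∉ M → EdgeLeaving M
  chain-edgeLeaving _ x∈M (here refl) y∉M = contradiction x∈M y∉M
  chain-edgeLeaving {M} {x} {x′ ∷ _} (a ∷ ch) x∈M (there y∈) y∉M with x′ ∈? M
  ... | yes x′∈M = chain-edgeLeaving ch x′∈M y∈ y∉M
  ... | no  x′∉M = x , x′ , x∈M , x′∉M , a

  connected⇒edgeLeaving : Connected G → ∀ {M x y} → x ∈ M → y ∉ M → EdgeLeaving M
  connected⇒edgeLeaving conn {x = x} {y} x∈M y∉M with conn x y
  ... | path _ ch _ , y∈ = chain-edgeLeaving ch x∈M y∈ y∉M

  non-neighbours-adjacent : ThreeK1Free G → ∀ {x y z} → x ≢ y → x ≢ z → y ≢ z →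
                            ¬ Adj x y → ¬ Adj x z → Adj y z
  non-neighbours-adjacent tk x≢y x≢z y≢z ¬xy ¬xz with tk _ _ _ x≢y y≢z x≢z
  ... | inj₁ xy        = contradiction xy ¬xy
  ... | inj₂ (inj₁ yz) = yz
  ... | inj₂ (inj₂ xz) = contradiction xz ¬xz

  -- With P = ps ++ c ∷ zs and Q ending in b, the new paths are ps ++ c ∷ xs and Q extended by ys.
  absorb : ThreeK1Free G → ∀ {c b w} zs → Chain G (c ∷ zs) → Adj c w → w ∉ b ∷ zs → b ∉ zs →
           ∃₂ λ xs ys → Chain G (c ∷ xs) × Chain G (b ∷ ys) × xs ++ ys ↭ w ∷ zs
  absorb tk {b = b} {w} zs ch _ _ _ with adj? w b
  ... | yes wb = zs , w ∷ [] , ch , Adj-sym wb ∷ [ w ] , ↭-sym (∷↭∷ʳ w zs)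
  absorb tk {b = b} {w} [] _ cw _ _ | no _ = w ∷ [] , [] , cw ∷ [ w ] , [ b ] , ↭-refl
  absorb tk {b = b} {w} (c′ ∷ zs) (_ ∷ ch) cw w∉ b∉ | no ¬wb with adj? w c′
  ... | yes wc′ = w ∷ c′ ∷ zs , [] , cw ∷ wc′ ∷ ch , [ b ] , ↭-reflexive (++-identityʳ _)
  ... | no ¬wc′ = w ∷ [] , c′ ∷ zs , cw ∷ [ w ] , bc′ ∷ ch , ↭-refl
    where
    bc′ : Adj b c′
    bc′ = non-neighbours-adjacent tk (w∉ ∘ here) (w∉ ∘ there ∘ here) (b∉ ∘ here) ¬wb ¬wc′

  record PathPair (u v : Fin n) : Set where
    constructor pathPair
    field
      P Q      : List (Fin n)
      P-head   : head P ≡ just u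
      Q-head   : head Q ≡ just v
      P-chain  : Chain G P
      Q-chain  : Chain G Q
      disjoint : Unique (P ++ Q)

    covered : List (Fin n)
    covered = P ++ Q

  open PathPair

  singletons : ∀ {u v} → u ≢ v → PathPair u v
  singletons {u} {v} u≢v =
    pathPair (u ∷ []) (v ∷ []) refl refl [ u ] [ v ]
      (Unique-∷ (λ { (here u≡v) → u≢v u≡v }) (Unique-∷ (λ ()) []))

  swap : ∀ {u v} → PathPair u v → PathPair v u
  swap (pathPair P Q Ph Qh Pc Qc d) = pathPair Q P Qh Ph Qc Pc (Unique-resp-↭ (++-comm P Q) d)

  covered-swap : ∀ {u v} (s : PathPair u v) → covered (swap s) ↭ covered s
  covered-swap s = ++-comm (Q s) (P s)

  Extension : ∀ {u v} → PathPair u v → Fin n → Set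
  Extension {u} {v} s w = Σ (PathPair u v) λ s′ → covered s′ ↭ w ∷ covered s

  extend-P : ThreeK1Free G → ∀ {u v c w} (s : PathPair u v) →
             w ∉ covered s → c ∈ P s → Adj c w → Extension s w
  extend-P tk {c = c} {w} (pathPair P Q Ph Qh Pc Qc d) w∉ c∈P cw
    with ps , zs , refl ← ∈-∃++ c∈P
    with initLast Q
  ... | qs ∷ʳ′ b =
    let xs , ys , cxs , bys , perm = absorb tk zs c-suffix cw w∉b∷zs b∉zs
        perm′ = ↭-splice ps qs xs ys zs perm
    in pathPair (ps ++ c ∷ xs) (qs ++ b ∷ ys) (trans (head-++-∷ ps) Ph) (trans (head-++-∷ qs) Qh)
         (chain-join ps c-prefix cxs) (chain-join qs Qc bys)
         (Unique-resp-↭ (↭-sym perm′) (Unique-∷ w∉ d)) , perm′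
    where
    c-prefix : Chain G (ps ++ c ∷ [])
    c-prefix = proj₁ (chain-split ps Pc)
    c-suffix : Chain G (c ∷ zs)
    c-suffix = proj₂ (chain-split ps Pc)
    w∉b∷zs : w ∉ b ∷ zs
    w∉b∷zs (here refl)  = w∉ (∈-++⁺ʳ (ps ++ c ∷ zs) (∈-++⁺ʳ qs (here refl)))
    w∉b∷zs (there w∈zs) = w∉ (∈-++⁺ˡ (∈-++⁺ʳ ps (there w∈zs)))
    b∉zs : b ∉ zs
    b∉zs b∈zs = proj₂ (proj₂ (Unique-++⁻ (ps ++ c ∷ zs) d))
                  (∈-++⁺ʳ ps (there b∈zs) , ∈-++⁺ʳ qs (here refl))

  extend : ThreeK1Free G → ∀ {u v c w} (s : PathPair u v) →
           w ∉ covered s → c ∈ covered s → Adj c w → Extension s w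
  extend tk s w∉ c∈ cw with ∈-++⁻ (P s) c∈
  ... | inj₁ c∈P = extend-P tk s w∉ c∈P cw
  ... | inj₂ c∈Q =
    let s′ , perm = extend-P tk (swap s) (w∉ ∘ ∈-resp-↭ (covered-swap s)) c∈Q cw
    in swap s′ , ↭-trans (covered-swap s′) (↭-trans perm (↭-prep _ (covered-swap s)))

  pathCover : ∀ {u v} (s : PathPair u v) → (∀ w → w ∈ covered s) → PC G u v
  pathCover (pathPair (u ∷ ps) (v ∷ qs) refl refl Pc Qc d) all∈ =
    let uP , uQ , _ = Unique-++⁻ (u ∷ ps) d
    in path ps Pc uP , path qs Qc uQ , d , all∈

  -- Recursion on k, a bound on the number of uncovered vertices that each step decreases.
  grow : Connected G → ThreeK1Free G → ∀ {u v k} (s : PathPair u v) → covered s ⊕ k → PC G u v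
  grow conn tk {k = zero} s count = pathCover s (lookup! count)
  grow conn tk {k = suc k} s count with all? (_∈? covered s)
  ... | yes all∈ = pathCover s all∈
  ... | no ¬all∈ =
    let y , y∉ = ¬∀⟶∃¬ n _ (_∈? covered s) ¬all∈
        c , w , c∈ , w∉ , cw = connected⇒edgeLeaving conn (∈-++⁺ˡ (head≡just⇒∈ (P-head s))) y∉
        s′ , perm = extend tk s w∉ c∈ cw
    in grow conn tk s′ (⊕-mono (∈-resp-↭ (↭-sym perm)) (insert count w w∉))

theorem10 : ∀ {n : ℕ} (G : Graph n) → Connected G → ThreeK1Free G →
    ∀ (u v : Fin n) → ¬ u ≡ v → PC G u v
theorem10 G conn tk u v u≢v = grow G conn tk (singletons G u≢v) (⊕-Fin _)
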